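{- Let $G$ be an extended $P_4$-laden graph of order $2n$. Then $G$ is a yes-instance of $\textsc{Comp-Sub}(\mathcal{PM})$ if and only if $G = K_n\overline{K}_n$.
   Context: All graphs are finite, simple and undirected. A graph is extended $P_4$-laden if every induced subgraph with at most six vertices that contains more than two induced $P_4$'s (paths on four vertices) contains neither $2K_2$ (two disjoint edges, induced) nor $C_4$ as an induced subgraph. $\textsc{Comp-Sub}(\mathcal{PM})$ is the decision problem: given a graph $G=(V,E)$, can $V$ be partitioned into $V_1,V_2$ such that $G[V_1]$ is isomorphic to the complement of $G[V_2]$ and the set of edges of $G$ between $V_1$ and $V_2$ is a perfect matching (every vertex is incident to exactly one such edge)? $K_n\overline{K}_n$ denotes the complementary prism of $K_n$: the disjoint union of a clique on $n$ vertices and an independent set on $n$ vertices together with a perfect matching between them. Equality of graphs is up to isomorphism. -}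

module Defs where

open import Data.Nat using (ℕ; _≤_; _*_; _+_)
open import Data.Bool using (Bool; true; false; not)
open import Data.Fin using (Fin; splitAt)
open import Data.Fin.Properties using (_≟_)
open import Data.Fin.Subset using (Subset; _∈_; ∣_∣)
open import Data.Sum using (_⊎_; inj₁; inj₂)
open import Data.Product using (Σ; ∃; _×_; _,_)
open import Data.Empty using (⊥; ⊥-elim)
open import Relation.Nullary using (¬_; Dec; yes; no)
open import Relation.Nullary.Decidable using (⌊_⌋)
open import Relation.Binary.PropositionalEquality using (_≡_; _≢_)
import Relation.Binary.PropositionalEquality as Eq
open import Function.Bundles using (_↔_; Inverse)

record Graph : Set where
  field
    size   : ℕ
    adj    : Fin size → Fin size → Bool
    sym    : ∀ u v → adj u v ≡ adj v u
    irrefl : ∀ u → adj u u ≡ false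

open Graph public

_≅_ : Graph → Graph → Set
G ≅ H = Σ (Fin (size G) ↔ Fin (size H)) λ f →
          ∀ u v → adj G u v ≡ adj H (Inverse.to f u) (Inverse.to f v)

P4adj : Fin 4 → Fin 4 → Bool
P4adj Fin.zero (Fin.suc Fin.zero) = true
P4adj (Fin.suc Fin.zero) Fin.zero = true
P4adj (Fin.suc Fin.zero) (Fin.suc (Fin.suc Fin.zero)) = true
P4adj (Fin.suc (Fin.suc Fin.zero)) (Fin.suc Fin.zero) = true
P4adj (Fin.suc (Fin.suc Fin.zero)) (Fin.suc (Fin.suc (Fin.suc Fin.zero))) = true
P4adj (Fin.suc (Fin.suc (Fin.suc Fin.zero))) (Fin.suc (Fin.suc Fin.zero)) = true
P4adj _ _ = false

TwoK2adj : Fin 4 → Fin 4 → Bool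
TwoK2adj Fin.zero (Fin.suc Fin.zero) = true
TwoK2adj (Fin.suc Fin.zero) Fin.zero = true
TwoK2adj (Fin.suc (Fin.suc Fin.zero)) (Fin.suc (Fin.suc (Fin.suc Fin.zero))) = true
TwoK2adj (Fin.suc (Fin.suc (Fin.suc Fin.zero))) (Fin.suc (Fin.suc Fin.zero)) = true
TwoK2adj _ _ = false

C4adj : Fin 4 → Fin 4 → Bool
C4adj Fin.zero (Fin.suc Fin.zero) = true
C4adj (Fin.suc Fin.zero) Fin.zero = true
C4adj (Fin.suc Fin.zero) (Fin.suc (Fin.suc Fin.zero)) = true
C4adj (Fin.suc (Fin.suc Fin.zero)) (Fin.suc Fin.zero) = true
C4adj (Fin.suc (Fin.suc Fin.zero)) (Fin.suc (Fin.suc (Fin.suc Fin.zero))) = true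
C4adj (Fin.suc (Fin.suc (Fin.suc Fin.zero))) (Fin.suc (Fin.suc Fin.zero)) = true
C4adj (Fin.suc (Fin.suc (Fin.suc Fin.zero))) Fin.zero = true
C4adj Fin.zero (Fin.suc (Fin.suc (Fin.suc Fin.zero))) = true
C4adj _ _ = false

InducedIn : (G : Graph) → Subset (size G) → (k : ℕ) → (Fin k → Fin k → Bool)
          → (Fin k → Fin (size G)) → Set
InducedIn G S k padj g =
  (∀ i → g i ∈ S) ×
  (∀ i j → g i ≡ g j → i ≡ j) ×
  (∀ i j → adj G (g i) (g j) ≡ padj i j)

DifferentImage : ∀ {n k} → (Fin k → Fin n) → (Fin k → Fin n) → Set
DifferentImage g₁ g₂ = ¬ (∀ i → ∃ λ j → g₁ i ≡ g₂ j)

MoreThanTwoP4 : (G : Graph) → Subset (size G) → Set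
MoreThanTwoP4 G S =
  Σ (Fin 4 → Fin (size G)) λ g₁ →
  Σ (Fin 4 → Fin (size G)) λ g₂ →
  Σ (Fin 4 → Fin (size G)) λ g₃ →
    InducedIn G S 4 P4adj g₁ × InducedIn G S 4 P4adj g₂ × InducedIn G S 4 P4adj g₃ ×
    DifferentImage g₁ g₂ × DifferentImage g₁ g₃ × DifferentImage g₂ g₃

ContainsInduced : (G : Graph) → Subset (size G) → (k : ℕ) → (Fin k → Fin k → Bool) → Set
ContainsInduced G S k padj = ∃ λ g → InducedIn G S k padj g

ExtendedP4Laden : Graph → Set
ExtendedP4Laden G =
  ∀ (S : Subset (size G)) → ∣ S ∣ ≤ 6 → MoreThanTwoP4 G S →
    ¬ ContainsInduced G S 4 TwoK2adj × ¬ ContainsInduced G S 4 C4adj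

-- Comp-Sub(PM) yes-instance. V₁ = {v | P v ≡ true}, V₂ = {v | P v ≡ false}.
-- f restricted to V₁ is an isomorphism from G[V₁] onto the complement of G[V₂].
CompSubPM : Graph → Set
CompSubPM G =
  Σ (Fin (size G) → Bool) λ P →
  Σ (Fin (size G) → Fin (size G)) λ f →
    (∀ u → P u ≡ true → P (f u) ≡ false) ×
    (∀ u w → P u ≡ true → P w ≡ true → f u ≡ f w → u ≡ w) ×
    (∀ v → P v ≡ false → ∃ λ u → P u ≡ true × f u ≡ v) ×
    (∀ u w → P u ≡ true → P w ≡ true → u ≢ w →
       adj G u w ≡ not (adj G (f u) (f w))) ×
    -- the edges between V₁ and V₂ form a perfect matching
    (∀ u → ∃ λ v → P v ≡ not (P u) × adj G u v ≡ true ×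
       (∀ w → P w ≡ not (P u) → adj G u w ≡ true → w ≡ v))

-- The complementary prism K_n K̄_n on Fin (n + n):
-- first n vertices form a clique, last n an independent set, i ↔ n+i matched.
KKadj : (n : ℕ) → Fin (n + n) → Fin (n + n) → Bool
KKadj n x y with splitAt n x | splitAt n y
... | inj₁ i | inj₁ j = not ⌊ i ≟ j ⌋
... | inj₁ i | inj₂ j = ⌊ i ≟ j ⌋
... | inj₂ i | inj₁ j = ⌊ i ≟ j ⌋
... | inj₂ i | inj₂ j = false


private
  ≟-sym : ∀ {m} (i j : Fin m) → ⌊ i ≟ j ⌋ ≡ ⌊ j ≟ i ⌋
  ≟-sym i j with i ≟ j | j ≟ i
  ... | yes _ | yes _ = Eq.refl
  ... | no _ | no _ = Eq.refl
  ... | yes p | no q = ⊥-elim (q (Eq.sym p))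
  ... | no p | yes q = ⊥-elim (p (Eq.sym q))

  ≟-refl : ∀ {m} (i : Fin m) → ⌊ i ≟ i ⌋ ≡ true
  ≟-refl i with i ≟ i
  ... | yes _ = Eq.refl
  ... | no p = ⊥-elim (p Eq.refl)

KK-sym : ∀ n x y → KKadj n x y ≡ KKadj n y x
KK-sym n x y with splitAt n x | splitAt n y
... | inj₁ i | inj₁ j = Eq.cong not (≟-sym i j)
... | inj₁ i | inj₂ j = ≟-sym i j
... | inj₂ i | inj₁ j = ≟-sym i j
... | inj₂ i | inj₂ j = Eq.refl

KK-irrefl : ∀ n x → KKadj n x x ≡ false
KK-irrefl n x with splitAt n x
... | inj₁ i = Eq.cong not (≟-refl i)
... | inj₂ i = Eq.refl

KnKnbar : ℕ → Graph
KnKnbar n = record { size = n + n ; adj = KKadj n ; sym = KK-sym n ; irrefl = KK-irrefl n }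

-- Let V₁, V₂, f and the perfect matching u ↦ u′ witness Comp-Sub(PM). For an induced
-- P₃ a-b-c inside one side, the six vertices a, b, c, a′, b′, c′ contain three induced
-- P₄'s and a 2K₂ or a C₄ whatever the edges among a′, b′, c′ are (an exhaustive check
-- over eight cases), so extended P₄-ladenness forbids induced P₃'s inside either side.
-- Since f maps the complement of G[V₁] isomorphically onto G[V₂], the complement of
-- G[V₁] has no induced P₃ either; a graph which together with its complement is
-- P₃-free is complete or edgeless. Hence one side is a clique, the other is independent,
-- and the matching makes G the complementary prism Kₙ K̄ₙ. Conversely, in Kₙ K̄ₙ the
-- matching itself maps the clique onto the complement of the independent set.

module Submission where

open import Defs
open import Data.Bool using (Bool; true; false; not)
open import Data.Bool.Properties using (not-involutive; not-injective; ¬-not; not-¬)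
  renaming (_≟_ to _≟ᵇ_)
open import Data.Empty using (⊥-elim)
open import Data.Fin using (Fin; zero; suc; splitAt; join)
open import Data.Fin.Patterns using (0F; 1F; 2F; 3F; 4F; 5F)
open import Data.Fin.Permutation using (↔⇒≡)
open import Data.Fin.Properties using (_≟_; all?; any?; splitAt-join; join-splitAt)
open import Data.Fin.Subset using (Subset; _∈_; ∣_∣; ⁅_⁆; _∪_) renaming (⊥ to ∅)
open import Data.Fin.Subset.Properties using (x∈⁅x⁆; ∣⁅x⁆∣≡1; ∣⊥∣≡0; x∈p∪q⁺; ∣p∣≤∣x∷p∣)
open import Data.List as List using (List)
import Data.List.Relation.Unary.All as All
import Data.List.Relation.Unary.AllPairs as AllPairs
import Data.List.Relation.Unary.Any as Any
open import Data.List.Relation.Unary.Any.Properties using (lookup-index)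
open import Data.List.Relation.Unary.Unique.Propositional using (Unique)
open import Data.List.Relation.Unary.Unique.Propositional.Properties using (filter⁺; allFin⁺)
open import Data.List.Membership.Propositional.Properties using (∈-lookup; ∈-filter⁺; ∈-filter⁻; ∈-allFin)
open import Data.Nat using (ℕ; zero; suc; _+_; _*_; _≤_; z≤n; s≤s)
open import Data.Nat.Properties using (*-cancelˡ-≡; +-identityʳ; ≤-refl; ≤-trans; +-suc; +-monoʳ-≤; module ≤-Reasoning)
open import Data.Product using (∃; _×_; _,_; proj₁; proj₂)
open import Data.Sum using (_⊎_; inj₁; inj₂; [_,_]′; swap)
open import Data.Vec.Functional using ([]; _∷_)
open import Function using (_∘_; const)
open import Function.Bundles using (_↔_; _⇔_; Inverse; Injection; mk⤖; mk⇔)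
open import Function.Consequences.Propositional using (strictlySurjective⇒surjective)
open import Function.Definitions using (Injective; StrictlySurjective)
open import Function.Properties.Bijection using (⤖⇒↔)
open import Function.Properties.Inverse using (↔-sym; ↔⇒↣)
open import Relation.Unary using (Decidable)
open import Relation.Nullary using (¬_; Dec; yes; no; map′; ¬?)
open import Relation.Nullary.Decidable using (⌊_⌋; _×-dec_; _⊎-dec_; _→-dec_; True; toWitness)
open import Relation.Binary.PropositionalEquality as ≡ using (_≡_; _≢_; refl; cong; cong₂; trans)

module _ where
  open import Data.Vec using ([]; _∷_)

  ∣p∪q∣≤∣p∣+∣q∣ : ∀ {n} (p q : Subset n) → ∣ p ∪ q ∣ ≤ ∣ p ∣ + ∣ q ∣
  ∣p∪q∣≤∣p∣+∣q∣ []          []          = z≤n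
  ∣p∪q∣≤∣p∣+∣q∣ (true ∷ p)  (x ∷ q)     = s≤s (≤-trans (∣p∪q∣≤∣p∣+∣q∣ p q) (+-monoʳ-≤ ∣ p ∣ (∣p∣≤∣x∷p∣ x q)))
  ∣p∪q∣≤∣p∣+∣q∣ (false ∷ p) (true ∷ q)  rewrite +-suc ∣ p ∣ ∣ q ∣ = s≤s (∣p∪q∣≤∣p∣+∣q∣ p q)
  ∣p∪q∣≤∣p∣+∣q∣ (false ∷ p) (false ∷ q) = ∣p∪q∣≤∣p∣+∣q∣ p q

image : ∀ {k N} → (Fin k → Fin N) → Subset N
image {zero}  h = ∅
image {suc k} h = ⁅ h zero ⁆ ∪ image (h ∘ suc)

∈-image : ∀ {k N} (h : Fin k → Fin N) i → h i ∈ image h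
∈-image h zero    = x∈p∪q⁺ (inj₁ (x∈⁅x⁆ (h zero)))
∈-image h (suc i) = x∈p∪q⁺ {p = ⁅ h zero ⁆} (inj₂ (∈-image (h ∘ suc) i))

∣image∣≤ : ∀ {k N} (h : Fin k → Fin N) → ∣ image h ∣ ≤ k
∣image∣≤ {zero}  {N} h rewrite ∣⊥∣≡0 N = z≤n
∣image∣≤ {suc k} h = begin
  ∣ ⁅ h zero ⁆ ∪ image (h ∘ suc) ∣     ≤⟨ ∣p∪q∣≤∣p∣+∣q∣ ⁅ h zero ⁆ (image (h ∘ suc)) ⟩
  ∣ ⁅ h zero ⁆ ∣ + ∣ image (h ∘ suc) ∣ ≡⟨ cong (_+ ∣ image (h ∘ suc) ∣) (∣⁅x⁆∣≡1 (h zero)) ⟩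
  suc ∣ image (h ∘ suc) ∣             ≤⟨ s≤s (∣image∣≤ (h ∘ suc)) ⟩
  suc k                               ∎
  where open ≤-Reasoning

splitAt-injective : ∀ m {n} → Injective _≡_ _≡_ (splitAt m {n})
splitAt-injective m {n} {x} {y} e = begin
  x                      ≡⟨ ≡.sym (join-splitAt m n x) ⟩
  join m n (splitAt m x) ≡⟨ cong (join m n) e ⟩
  join m n (splitAt m y) ≡⟨ join-splitAt m n y ⟩
  y                      ∎
  where open ≡.≡-Reasoning

triple-injective : ∀ {A : Set} {a b c : A} → a ≢ b → a ≢ c → b ≢ c → Injective _≡_ _≡_ (a ∷ b ∷ c ∷ [])
triple-injective a≢b a≢c b≢c {0F} {0F} _ = refl
triple-injective a≢b a≢c b≢c {0F} {1F} e = ⊥-elim (a≢b e)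
triple-injective a≢b a≢c b≢c {0F} {2F} e = ⊥-elim (a≢c e)
triple-injective a≢b a≢c b≢c {1F} {0F} e = ⊥-elim (a≢b (≡.sym e))
triple-injective a≢b a≢c b≢c {1F} {1F} _ = refl
triple-injective a≢b a≢c b≢c {1F} {2F} e = ⊥-elim (b≢c e)
triple-injective a≢b a≢c b≢c {2F} {0F} e = ⊥-elim (a≢c (≡.sym e))
triple-injective a≢b a≢c b≢c {2F} {1F} e = ⊥-elim (b≢c (≡.sym e))
triple-injective a≢b a≢c b≢c {2F} {2F} _ = refl

lookup-injective : ∀ {A : Set} {xs : List A} → Unique xs → Injective _≡_ _≡_ (List.lookup xs)
lookup-injective (x∉xs AllPairs.∷ u) {zero}  {zero}  _ = refl
lookup-injective (x∉xs AllPairs.∷ u) {zero}  {suc j} e = ⊥-elim (All.lookup x∉xs (∈-lookup j) e)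
lookup-injective (x∉xs AllPairs.∷ u) {suc i} {zero}  e = ⊥-elim (All.lookup x∉xs (∈-lookup i) (≡.sym e))
lookup-injective (x∉xs AllPairs.∷ u) {suc i} {suc j} e = cong suc (lookup-injective u e)

record Enumeration {N : ℕ} (S : Fin N → Set) : Set where
  field
    count              : ℕ
    element            : Fin count → Fin N
    element-injective  : Injective _≡_ _≡_ element
    element-∈          : ∀ i → S (element i)
    element-surjective : ∀ v → S v → ∃ λ i → element i ≡ v

enumerate : ∀ {N} {S : Fin N → Set} → Decidable S → Enumeration S
enumerate {N} S? = record
  { count              = List.length xs
  ; element            = List.lookup xs
  ; element-injective  = lookup-injective (filter⁺ S? (allFin⁺ N))
  ; element-∈          = λ i → proj₂ (∈-filter⁻ S? {xs = List.allFin N} (∈-lookup i))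
  ; element-surjective = λ v Sv → let v∈xs = ∈-filter⁺ S? (∈-allFin v) Sv in
                                  Any.index v∈xs , ≡.sym (lookup-index v∈xs)
  }
  where
  xs : List (Fin N)
  xs = List.filter S? (List.allFin N)

bijective⇒≅ : ∀ G H (φ : Fin (size H) → Fin (size G)) → Injective _≡_ _≡_ φ → StrictlySurjective _≡_ φ →
  (∀ x y → adj G (φ x) (φ y) ≡ adj H x y) → G ≅ H
bijective⇒≅ G H φ injective surjective φ-adj = ψ , ψ-adj
  where
  ψ : Fin (size G) ↔ Fin (size H)
  ψ = ↔-sym (⤖⇒↔ (mk⤖ (injective , strictlySurjective⇒surjective surjective)))
  open Inverse ψ
  ψ-adj : ∀ u v → adj G u v ≡ adj H (to u) (to v)
  ψ-adj u v = trans (≡.sym (cong₂ (adj G) (strictlyInverseʳ u) (strictlyInverseʳ v))) (φ-adj (to u) (to v))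

-- Forbidden configurations on at most six vertices

Pattern : ℕ → Set
Pattern k = Fin k → Fin k → Bool

Embeds : ∀ {k l} → Pattern k → Pattern l → (Fin l → Fin k) → Set
Embeds T B σ = Injective _≡_ _≡_ σ × (∀ i j → T (σ i) (σ j) ≡ B i j)

injective? : ∀ {k l} (σ : Fin l → Fin k) → Dec (Injective _≡_ _≡_ σ)
injective? σ = map′ (λ inj {i} {j} → inj i j) (λ inj i j → inj)
  (all? λ i → all? λ j → (σ i ≟ σ j) →-dec (i ≟ j))

embeds? : ∀ {k l} (T : Pattern k) (B : Pattern l) σ → Dec (Embeds T B σ)
embeds? T B σ = injective? σ ×-dec (all? λ i → all? λ j → T (σ i) (σ j) ≟ᵇ B i j)

differentImage? : ∀ {k l} (σ τ : Fin l → Fin k) → Dec (DifferentImage σ τ)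
differentImage? σ τ = ¬? (all? λ i → any? λ j → σ i ≟ τ j)

Violates : ∀ {k} → Pattern k → (σ₁ σ₂ σ₃ τ : Fin 4 → Fin k) → Set
Violates T σ₁ σ₂ σ₃ τ =
  (Embeds T P4adj σ₁ × Embeds T P4adj σ₂ × Embeds T P4adj σ₃) ×
  (DifferentImage σ₁ σ₂ × DifferentImage σ₁ σ₃ × DifferentImage σ₂ σ₃) ×
  (Embeds T TwoK2adj τ ⊎ Embeds T C4adj τ)

violates? : ∀ {k} (T : Pattern k) σ₁ σ₂ σ₃ τ → Dec (Violates T σ₁ σ₂ σ₃ τ)
violates? T σ₁ σ₂ σ₃ τ =
  (embeds? T P4adj σ₁ ×-dec embeds? T P4adj σ₂ ×-dec embeds? T P4adj σ₃) ×-dec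
  (differentImage? σ₁ σ₂ ×-dec differentImage? σ₁ σ₃ ×-dec differentImage? σ₂ σ₃) ×-dec
  (embeds? T TwoK2adj τ ⊎-dec embeds? T C4adj τ)

record LadenViolation {k} (T : Pattern k) : Set where
  field
    σ₁ σ₂ σ₃ τ : Fin 4 → Fin k
    violates : Violates T σ₁ σ₂ σ₃ τ

checkedViolation : ∀ {k} {T : Pattern k} σ₁ σ₂ σ₃ τ → {True (violates? T σ₁ σ₂ σ₃ τ)} → LadenViolation T
checkedViolation σ₁ σ₂ σ₃ τ {ok} = record { σ₁ = σ₁ ; σ₂ = σ₂ ; σ₃ = σ₃ ; τ = τ ; violates = toWitness ok }

laden⇒¬violation : ∀ {G k} {T : Pattern k} → ExtendedP4Laden G → k ≤ 6 →
  (h : Fin k → Fin (size G)) → Injective _≡_ _≡_ h → (∀ i j → adj G (h i) (h j) ≡ T i j) →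
  ¬ LadenViolation T
laden⇒¬violation {G} {k} {T} laden k≤6 h h-injective h-adj record
  { violates = (P4₁ , P4₂ , P4₃) , (d₁₂ , d₁₃ , d₂₃) , forbidden } =
  [ (λ e → proj₁ verdict (_ , induced e)) , (λ e → proj₂ verdict (_ , induced e)) ]′ forbidden
  where
  induced : ∀ {B} {σ : Fin 4 → Fin k} → Embeds T B σ → InducedIn G (image h) 4 B (h ∘ σ)
  induced (σ-injective , σ-adj) =
    (λ i → ∈-image h _) , (λ i j → σ-injective ∘ h-injective) , (λ i j → trans (h-adj _ _) (σ-adj i j))
  different : ∀ {σ τ : Fin 4 → Fin k} → DifferentImage σ τ → DifferentImage (h ∘ σ) (h ∘ τ)
  different d covered = d (λ i → proj₁ (covered i) , h-injective (proj₂ (covered i)))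
  verdict : ¬ ContainsInduced G (image h) 4 TwoK2adj × ¬ ContainsInduced G (image h) 4 C4adj
  verdict = laden (image h) (≤-trans (∣image∣≤ h) k≤6)
    (_ , _ , _ , induced P4₁ , induced P4₂ , induced P4₃ , different d₁₂ , different d₁₃ , different d₂₃)

-- Prisms: patterns B, B′ on two copies of Fin k joined by the matching i ↔ i

prismAdj : ∀ {k} → Pattern k → Pattern k → Fin k ⊎ Fin k → Fin k ⊎ Fin k → Bool
prismAdj B B′ (inj₁ i) (inj₁ j) = B i j
prismAdj B B′ (inj₁ i) (inj₂ j) = ⌊ i ≟ j ⌋
prismAdj B B′ (inj₂ i) (inj₁ j) = ⌊ i ≟ j ⌋
prismAdj B B′ (inj₂ i) (inj₂ j) = B′ i j

prism : ∀ {k} → Pattern k → Pattern k → Pattern (k + k)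
prism {k} B B′ x y = prismAdj B B′ (splitAt k x) (splitAt k y)

prismAdj-cong : ∀ {k} {B C B′ C′ : Pattern k} → (∀ i j → B i j ≡ C i j) → (∀ i j → B′ i j ≡ C′ i j) →
  ∀ s t → prismAdj B B′ s t ≡ prismAdj C C′ s t
prismAdj-cong B≗C B′≗C′ (inj₁ i) (inj₁ j) = B≗C i j
prismAdj-cong B≗C B′≗C′ (inj₁ i) (inj₂ j) = refl
prismAdj-cong B≗C B′≗C′ (inj₂ i) (inj₁ j) = refl
prismAdj-cong B≗C B′≗C′ (inj₂ i) (inj₂ j) = B′≗C′ i j

complete : ∀ {k} → Pattern k
complete i j = not ⌊ i ≟ j ⌋

empty : ∀ {k} → Pattern k
empty i j = false

KKadj≡prism : ∀ n x y → KKadj n x y ≡ prism {n} complete empty x y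
KKadj≡prism n x y with splitAt n x | splitAt n y
... | inj₁ i | inj₁ j = refl
... | inj₁ i | inj₂ j = refl
... | inj₂ i | inj₁ j = refl
... | inj₂ i | inj₂ j = refl

triangle : Bool → Bool → Bool → Pattern 3
triangle x y z 0F 1F = x
triangle x y z 1F 0F = x
triangle x y z 0F 2F = y
triangle x y z 2F 0F = y
triangle x y z 1F 2F = z
triangle x y z 2F 1F = z
triangle x y z _  _  = false

-- Vertices 0, 1, 2 form the path a-b-c and 3, 4, 5 are their partners, with unknown
-- edges x, y, z among the partners. Each line names three P₄'s with pairwise different
-- vertex sets and a 2K₂ or C₄; the claims are checked by evaluation.
matchedP3-violation : ∀ x y z → LadenViolation (prism (triangle true false true) (triangle x y z))
matchedP3-violation false false false = checkedViolation (0F ∷ 1F ∷ 2F ∷ 5F ∷ []) (2F ∷ 1F ∷ 0F ∷ 3F ∷ []) (3F ∷ 0F ∷ 1F ∷ 4F ∷ []) (0F ∷ 3F ∷ 2F ∷ 5F ∷ [])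
matchedP3-violation false false true  = checkedViolation (0F ∷ 1F ∷ 2F ∷ 5F ∷ []) (0F ∷ 1F ∷ 4F ∷ 5F ∷ []) (2F ∷ 1F ∷ 0F ∷ 3F ∷ []) (0F ∷ 3F ∷ 2F ∷ 5F ∷ [])
matchedP3-violation false true  false = checkedViolation (0F ∷ 1F ∷ 2F ∷ 5F ∷ []) (0F ∷ 3F ∷ 5F ∷ 2F ∷ []) (1F ∷ 0F ∷ 3F ∷ 5F ∷ []) (1F ∷ 4F ∷ 3F ∷ 5F ∷ [])
matchedP3-violation false true  true  = checkedViolation (0F ∷ 1F ∷ 2F ∷ 5F ∷ []) (0F ∷ 1F ∷ 4F ∷ 5F ∷ []) (0F ∷ 3F ∷ 5F ∷ 2F ∷ []) (1F ∷ 2F ∷ 5F ∷ 4F ∷ [])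
matchedP3-violation true  false false = checkedViolation (0F ∷ 1F ∷ 2F ∷ 5F ∷ []) (2F ∷ 1F ∷ 0F ∷ 3F ∷ []) (2F ∷ 1F ∷ 4F ∷ 3F ∷ []) (0F ∷ 1F ∷ 4F ∷ 3F ∷ [])
matchedP3-violation true  false true  = checkedViolation (0F ∷ 1F ∷ 2F ∷ 5F ∷ []) (0F ∷ 1F ∷ 4F ∷ 5F ∷ []) (0F ∷ 3F ∷ 4F ∷ 5F ∷ []) (0F ∷ 1F ∷ 4F ∷ 3F ∷ [])
matchedP3-violation true  true  false = checkedViolation (0F ∷ 1F ∷ 2F ∷ 5F ∷ []) (0F ∷ 3F ∷ 5F ∷ 2F ∷ []) (1F ∷ 0F ∷ 3F ∷ 5F ∷ []) (0F ∷ 1F ∷ 4F ∷ 3F ∷ [])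
matchedP3-violation true  true  true  = checkedViolation (0F ∷ 1F ∷ 2F ∷ 5F ∷ []) (0F ∷ 1F ∷ 4F ∷ 5F ∷ []) (0F ∷ 3F ∷ 5F ∷ 2F ∷ []) (0F ∷ 1F ∷ 4F ∷ 3F ∷ [])

-- Perfect matchings between the two sides of a partition

adjacent⇒≢ : ∀ (G : Graph) {u v} → adj G u v ≡ true → u ≢ v
adjacent⇒≢ G {u} uv refl = not-¬ (irrefl G u) uv

CrossMatching : (G : Graph) → (Fin (size G) → Bool) → Set
CrossMatching G side = ∀ u → ∃ λ v → side v ≡ not (side u) × adj G u v ≡ true ×
  (∀ w → side w ≡ not (side u) → adj G u w ≡ true → w ≡ v)

module CrossMatching {G : Graph} {side : Fin (size G) → Bool} (M : CrossMatching G side) where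

  partner : Fin (size G) → Fin (size G)
  partner u = proj₁ (M u)

  partner-side : ∀ u → side (partner u) ≡ not (side u)
  partner-side u = proj₁ (proj₂ (M u))

  partner-adj : ∀ u → adj G u (partner u) ≡ true
  partner-adj u = proj₁ (proj₂ (proj₂ (M u)))

  partner-unique : ∀ u w → side w ≡ not (side u) → adj G u w ≡ true → w ≡ partner u
  partner-unique u = proj₂ (proj₂ (proj₂ (M u)))

  partner-side′ : ∀ u → side u ≡ not (side (partner u))
  partner-side′ u = trans (≡.sym (not-involutive (side u))) (cong not (≡.sym (partner-side u)))

  partner-involutive : ∀ u → partner (partner u) ≡ u
  partner-involutive u = ≡.sym (partner-unique (partner u) u
    (partner-side′ u) (trans (sym G (partner u) u) (partner-adj u)))

  partner-injective : Injective _≡_ _≡_ partner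
  partner-injective {u} {v} e = begin
    u                   ≡⟨ ≡.sym (partner-involutive u) ⟩
    partner (partner u) ≡⟨ cong partner e ⟩
    partner (partner v) ≡⟨ partner-involutive v ⟩
    v                   ∎
    where open ≡.≡-Reasoning

  sameSide-adj-partner : ∀ {u v} → side u ≡ side v → adj G u (partner v) ≡ true → u ≡ v
  sameSide-adj-partner {u} {v} uv e = begin
    u                   ≡⟨ partner-unique (partner v) u (trans uv (partner-side′ v)) (trans (sym G (partner v) u) e) ⟩
    partner (partner v) ≡⟨ partner-involutive v ⟩
    v                   ∎
    where open ≡.≡-Reasoning

  module PrismMap {k} (w : Fin k → Fin (size G)) {s : Bool} (w-side : ∀ i → side (w i) ≡ s)
                  (w-injective : Injective _≡_ _≡_ w) where

    prismMap : Fin k ⊎ Fin k → Fin (size G)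
    prismMap = [ w , partner ∘ w ]′

    opposite-sides : ∀ i j → w i ≢ partner (w j)
    opposite-sides i j e = not-¬ (w-side i) (trans (cong side e) (trans (partner-side (w j)) (cong not (w-side j))))

    prismMap-injective : Injective _≡_ _≡_ prismMap
    prismMap-injective {inj₁ i} {inj₁ j} e = cong inj₁ (w-injective e)
    prismMap-injective {inj₁ i} {inj₂ j} e = ⊥-elim (opposite-sides i j e)
    prismMap-injective {inj₂ i} {inj₁ j} e = ⊥-elim (opposite-sides j i (≡.sym e))
    prismMap-injective {inj₂ i} {inj₂ j} e = cong inj₂ (w-injective (partner-injective e))

    prismMap-surjective : (∀ v → side v ≡ s → ∃ λ i → w i ≡ v) → ∀ v → ∃ λ t → prismMap t ≡ v
    prismMap-surjective w-onto v with side v ≟ᵇ s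
    ... | yes vs = inj₁ (proj₁ (w-onto v vs)) , proj₂ (w-onto v vs)
    ... | no v≢s = inj₂ (proj₁ onto-partner) , trans (cong partner (proj₂ onto-partner)) (partner-involutive v)
      where
      onto-partner : ∃ λ i → w i ≡ partner v
      onto-partner = w-onto (partner v) (trans (partner-side v) (trans (cong not (¬-not v≢s)) (not-involutive s)))

    adj-partner⇒≡ : ∀ i j → adj G (w i) (partner (w j)) ≡ true → i ≡ j
    adj-partner⇒≡ i j = w-injective ∘ sameSide-adj-partner (trans (w-side i) (≡.sym (w-side j)))

    adj-prismMap : ∀ s t → adj G (prismMap s) (prismMap t) ≡
                   prismAdj (λ i j → adj G (w i) (w j)) (λ i j → adj G (partner (w i)) (partner (w j))) s t
    adj-prismMap (inj₁ i) (inj₁ j) = refl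
    adj-prismMap (inj₁ i) (inj₂ j) with i ≟ j
    ... | yes refl = partner-adj (w i)
    ... | no i≢j   = ¬-not (i≢j ∘ adj-partner⇒≡ i j)
    adj-prismMap (inj₂ i) (inj₁ j) with i ≟ j
    ... | yes refl = trans (sym G (partner (w i)) (w i)) (partner-adj (w i))
    ... | no i≢j   = ¬-not (i≢j ∘ ≡.sym ∘ adj-partner⇒≡ j i ∘ trans (sym G (w j) (partner (w i))))
    adj-prismMap (inj₂ i) (inj₂ j) = refl

CrossMatching-not : ∀ {G side} → CrossMatching G side → CrossMatching G (not ∘ side)
CrossMatching-not M u with M u
... | v , v-side , uv , unique = v , cong not v-side , uv , λ w w-side → unique w (not-injective w-side)

CrossMatching-transport : ∀ {G H side} ((φ , _) : G ≅ H) → CrossMatching H side →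
  CrossMatching G (side ∘ Inverse.to φ)
CrossMatching-transport {G} {H} {side} (φ , φ-adj) M u =
  from (partner (to u)) , from-partner-side , from-partner-adj , from-partner-unique
  where
  open Inverse φ
  open CrossMatching {H} {side} M
  from-partner-side : side (to (from (partner (to u)))) ≡ not (side (to u))
  from-partner-side = trans (cong side (strictlyInverseˡ _)) (partner-side (to u))
  from-partner-adj : adj G u (from (partner (to u))) ≡ true
  from-partner-adj = trans (φ-adj u _) (trans (cong (adj H (to u)) (strictlyInverseˡ _)) (partner-adj (to u)))
  from-partner-unique : ∀ w → side (to w) ≡ not (side (to u)) → adj G u w ≡ true → w ≡ from (partner (to u))
  from-partner-unique w w-side uw = trans (≡.sym (strictlyInverseʳ w))
    (cong from (partner-unique (to u) (to w) w-side (trans (≡.sym (φ-adj u w)) uw)))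

-- Induced P₃'s and their complements

adj-triangle : ∀ (G : Graph) (u : Fin 3 → Fin (size G)) {x y z} →
  adj G (u 0F) (u 1F) ≡ x → adj G (u 0F) (u 2F) ≡ y → adj G (u 1F) (u 2F) ≡ z →
  ∀ i j → adj G (u i) (u j) ≡ triangle x y z i j
adj-triangle G u ab ac bc 0F 0F = irrefl G _
adj-triangle G u ab ac bc 0F 1F = ab
adj-triangle G u ab ac bc 0F 2F = ac
adj-triangle G u ab ac bc 1F 0F = trans (sym G _ _) ab
adj-triangle G u ab ac bc 1F 1F = irrefl G _
adj-triangle G u ab ac bc 1F 2F = bc
adj-triangle G u ab ac bc 2F 0F = trans (sym G _ _) ac
adj-triangle G u ab ac bc 2F 1F = trans (sym G _ _) bc
adj-triangle G u ab ac bc 2F 2F = irrefl G _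

-- An induced path a-b-c of G (e = true) or of its complement (e = false).
InducedP3 : (G : Graph) → Bool → (a b c : Fin (size G)) → Set
InducedP3 G e a b c = adj G a b ≡ e × adj G b c ≡ e × adj G a c ≡ not e × a ≢ c

sameSide-¬InducedP3 : ∀ {G side} → ExtendedP4Laden G → CrossMatching G side →
  ∀ {a b c} → side a ≡ side b → side b ≡ side c → ¬ InducedP3 G true a b c
sameSide-¬InducedP3 {G} {side} laden M {a} {b} {c} ab-side bc-side (ab , bc , ac , a≢c) =
  laden⇒¬violation {G} laden ≤-refl h h-injective h-adj (matchedP3-violation _ _ _)
  where
  open CrossMatching {G} {side} M
  w : Fin 3 → Fin (size G)
  w = a ∷ b ∷ c ∷ []
  w-side : ∀ i → side (w i) ≡ side a
  w-side 0F = refl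
  w-side 1F = ≡.sym ab-side
  w-side 2F = ≡.sym (trans ab-side bc-side)
  w-injective : Injective _≡_ _≡_ w
  w-injective = triple-injective (adjacent⇒≢ G ab) a≢c (adjacent⇒≢ G bc)
  open PrismMap w w-side w-injective
  h : Fin 6 → Fin (size G)
  h = prismMap ∘ splitAt 3
  h-injective : Injective _≡_ _≡_ h
  h-injective = splitAt-injective 3 ∘ prismMap-injective
  partners : Pattern 3
  partners = triangle (adj G (partner a) (partner b)) (adj G (partner a) (partner c)) (adj G (partner b) (partner c))
  h-adj : ∀ x y → adj G (h x) (h y) ≡ prism (triangle true false true) partners x y
  h-adj x y = trans (adj-prismMap (splitAt 3 x) (splitAt 3 y))
    (prismAdj-cong (adj-triangle G w ab ac bc) (adj-triangle G (partner ∘ w) refl refl refl) (splitAt 3 x) (splitAt 3 y))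

Homogeneous : (G : Graph) → (Fin (size G) → Set) → Bool → Set
Homogeneous G S b = ∀ u v → S u → S v → u ≢ v → adj G u v ≡ b

P3-free⇒homogeneous : ∀ (G : Graph) (Q : Fin (size G) → Bool) →
  (∀ e {a b c} → Q a ≡ true → Q b ≡ true → Q c ≡ true → ¬ InducedP3 G e a b c) →
  ∃ (Homogeneous G (λ v → Q v ≡ true))
P3-free⇒homogeneous G Q P3-free
  with any? (λ u → any? λ v → (Q u ≟ᵇ true) ×-dec (Q v ≟ᵇ true) ×-dec (adj G u v ≟ᵇ true))
... | no no-edge = false , λ u v qu qv _ → ¬-not (λ uv → no-edge (u , v , qu , qv , uv))
... | yes (x , y , qx , qy , xy) = true , all-adjacent
  where
  extend : ∀ {u v w} → Q u ≡ true → Q v ≡ true → Q w ≡ true →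
           adj G u v ≡ true → u ≢ w → adj G u w ≡ true
  extend {u} {v} {w} qu qv qw uv u≢w with adj G u w in uw | adj G v w in vw
  ... | true  | _     = refl
  ... | false | true  = ⊥-elim (P3-free true qu qv qw (uv , vw , uw , u≢w))
  ... | false | false = ⊥-elim (P3-free false qu qw qv (uw , trans (sym G w v) vw , uv , adjacent⇒≢ G uv))
  neighbour : ∀ {p} → Q p ≡ true → ∃ λ r → Q r ≡ true × adj G p r ≡ true
  neighbour {p} qp with x ≟ p
  ... | yes refl = y , qy , xy
  ... | no x≢p   = x , qx , trans (sym G p x) (extend qx qy qp xy x≢p)
  all-adjacent : Homogeneous G (λ v → Q v ≡ true) true
  all-adjacent p q qp qq p≢q with neighbour qp
  ... | r , qr , pr = extend qp qr qq pr p≢q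

-- Graphs split into a clique and an independent set by a perfect matching

record IsKnKnbar (G : Graph) : Set where
  field
    side        : Fin (size G) → Bool
    matching    : CrossMatching G side
    clique      : Homogeneous G (λ v → side v ≡ true) true
    independent : Homogeneous G (λ v → side v ≡ false) false

CompSubPM⇒IsKnKnbar : ∀ {G} → ExtendedP4Laden G → CompSubPM G → IsKnKnbar G
CompSubPM⇒IsKnKnbar {G} laden (P , f , f-side , f-injective , f-onto , f-adj , M) =
  fromHomogeneousV₁ (P3-free⇒homogeneous G P P3-freeV₁)
  where
  f-adj′ : ∀ {u w e} → P u ≡ true → P w ≡ true → u ≢ w → adj G u w ≡ e → adj G (f u) (f w) ≡ not e
  f-adj′ {u} {w} {e} pu pw u≢w uw = not-injective (begin
    not (adj G (f u) (f w)) ≡⟨ ≡.sym (f-adj u w pu pw u≢w) ⟩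
    adj G u w               ≡⟨ uw ⟩
    e                       ≡⟨ ≡.sym (not-involutive e) ⟩
    not (not e)             ∎)
    where open ≡.≡-Reasoning
  same-f-side : ∀ {u v} → P u ≡ true → P v ≡ true → P (f u) ≡ P (f v)
  same-f-side pu pv = trans (f-side _ pu) (≡.sym (f-side _ pv))
  P3-freeV₁ : ∀ e {a b c} → P a ≡ true → P b ≡ true → P c ≡ true → ¬ InducedP3 G e a b c
  P3-freeV₁ true pa pb pc = sameSide-¬InducedP3 {G} {P} laden M (trans pa (≡.sym pb)) (trans pb (≡.sym pc))
  P3-freeV₁ false {a} {b} {c} pa pb pc (ab , bc , ac , a≢c) =
    sameSide-¬InducedP3 {G} {P} laden M (same-f-side pa pb) (same-f-side pb pc)
      (f-adj′ pa pb a≢b ab , f-adj′ pb pc b≢c bc , f-adj′ pa pc a≢c ac , a≢c ∘ f-injective a c pa pc)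
    where
    a≢b : a ≢ b
    a≢b refl = not-¬ bc ac
    b≢c : b ≢ c
    b≢c refl = not-¬ ab ac
  V₂-homogeneous : ∀ {b} → Homogeneous G (λ v → P v ≡ true) b → Homogeneous G (λ v → P v ≡ false) (not b)
  V₂-homogeneous h u v pu pv u≢v with f-onto u pu | f-onto v pv
  ... | u′ , pu′ , refl | v′ , pv′ , refl = f-adj′ pu′ pv′ u′≢v′ (h u′ v′ pu′ pv′ u′≢v′)
    where
    u′≢v′ : u′ ≢ v′
    u′≢v′ = u≢v ∘ cong f
  fromHomogeneousV₁ : ∃ (Homogeneous G (λ v → P v ≡ true)) → IsKnKnbar G
  fromHomogeneousV₁ (true , h) = record
    { side = P ; matching = M ; clique = h ; independent = V₂-homogeneous h }
  fromHomogeneousV₁ (false , h) = record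
    { side        = not ∘ P
    ; matching    = CrossMatching-not {G} {P} M
    ; clique      = λ u v pu pv → V₂-homogeneous h u v (not-injective pu) (not-injective pv)
    ; independent = λ u v pu pv → h u v (not-injective pu) (not-injective pv)
    }

IsKnKnbar⇒∃≅ : ∀ {G} → IsKnKnbar G → ∃ λ k → G ≅ KnKnbar k
IsKnKnbar⇒∃≅ {G} K = count , bijective⇒≅ G (KnKnbar count) φ φ-injective φ-surjective φ-adj
  where
  open IsKnKnbar K
  open CrossMatching {G} {side} matching
  open Enumeration (enumerate (λ v → side v ≟ᵇ true))
  open PrismMap element element-∈ element-injective
  clique-pattern : ∀ i j → adj G (element i) (element j) ≡ complete i j
  clique-pattern i j with i ≟ j
  ... | yes refl = irrefl G _
  ... | no i≢j   = clique _ _ (element-∈ i) (element-∈ j) (i≢j ∘ element-injective)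
  independent-pattern : ∀ i j → adj G (partner (element i)) (partner (element j)) ≡ empty i j
  independent-pattern i j with i ≟ j
  ... | yes refl = irrefl G _
  ... | no i≢j   = independent _ _ (side-false i) (side-false j) (i≢j ∘ element-injective ∘ partner-injective)
    where
    side-false : ∀ i → side (partner (element i)) ≡ false
    side-false i = trans (partner-side _) (cong not (element-∈ i))
  φ : Fin (count + count) → Fin (size G)
  φ = prismMap ∘ splitAt count
  φ-surjective : StrictlySurjective _≡_ φ
  φ-surjective v with prismMap-surjective element-surjective v
  ... | t , t↦v = join count count t , trans (cong prismMap (splitAt-join count count t)) t↦v
  φ-adj : ∀ x y → adj G (φ x) (φ y) ≡ KKadj count x y
  φ-adj x y = begin
    adj G (φ x) (φ y)
      ≡⟨ adj-prismMap (splitAt count x) (splitAt count y) ⟩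
    prismAdj _ _ (splitAt count x) (splitAt count y)
      ≡⟨ prismAdj-cong clique-pattern independent-pattern (splitAt count x) (splitAt count y) ⟩
    prism {count} complete empty x y
      ≡⟨ ≡.sym (KKadj≡prism count x y) ⟩
    KKadj count x y ∎
    where open ≡.≡-Reasoning
  φ-injective : Injective _≡_ _≡_ φ
  φ-injective = splitAt-injective count ∘ prismMap-injective

≅KnKnbar⇒order : ∀ {G k n} → G ≅ KnKnbar k → size G ≡ 2 * n → k ≡ n
≅KnKnbar⇒order {G} {k} {n} (φ , _) |G|≡2n = *-cancelˡ-≡ k n 2 (begin
  2 * k   ≡⟨ cong (k +_) (+-identityʳ k) ⟩
  k + k   ≡⟨ ≡.sym (↔⇒≡ φ) ⟩
  size G  ≡⟨ |G|≡2n ⟩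
  2 * n   ∎)
  where open ≡.≡-Reasoning

IsKnKnbar⇒≅ : ∀ {G n} → IsKnKnbar G → size G ≡ 2 * n → G ≅ KnKnbar n
IsKnKnbar⇒≅ {G} {n} K |G|≡2n with IsKnKnbar⇒∃≅ K
... | k , G≅KₖK̄ₖ = ≡.subst (λ k → G ≅ KnKnbar k) (≅KnKnbar⇒order {G} {k} {n} G≅KₖK̄ₖ |G|≡2n) G≅KₖK̄ₖ

IsKnKnbar⇒CompSubPM : ∀ {G} → IsKnKnbar G → CompSubPM G
IsKnKnbar⇒CompSubPM {G} K =
  side , partner , partner-V₂ , (λ _ _ _ _ → partner-injective) , onto , adj-complement , matching
  where
  open IsKnKnbar K
  open CrossMatching {G} {side} matching
  partner-V₂ : ∀ u → side u ≡ true → side (partner u) ≡ false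
  partner-V₂ u su = trans (partner-side u) (cong not su)
  onto : ∀ v → side v ≡ false → ∃ λ u → side u ≡ true × partner u ≡ v
  onto v sv = partner v , trans (partner-side v) (cong not sv) , partner-involutive v
  adj-complement : ∀ u w → side u ≡ true → side w ≡ true → u ≢ w → adj G u w ≡ not (adj G (partner u) (partner w))
  adj-complement u w su sw u≢w = trans (clique u w su sw u≢w)
    (cong not (≡.sym (independent _ _ (partner-V₂ u su) (partner-V₂ w sw) (u≢w ∘ partner-injective))))

IsKnKnbar-transport : ∀ {G H} → G ≅ H → IsKnKnbar H → IsKnKnbar G
IsKnKnbar-transport {G} {H} (φ , φ-adj) K = record
  { side        = side ∘ to
  ; matching    = CrossMatching-transport {G} {H} {side} (φ , φ-adj) matching
  ; clique      = λ u v su sv u≢v → trans (φ-adj u v) (clique _ _ su sv (u≢v ∘ to-injective))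
  ; independent = λ u v su sv u≢v → trans (φ-adj u v) (independent _ _ su sv (u≢v ∘ to-injective))
  }
  where
  open IsKnKnbar K
  open Inverse φ
  to-injective : Injective _≡_ _≡_ to
  to-injective = Injection.injective (↔⇒↣ φ)

inLeft : ∀ {k} → Fin k ⊎ Fin k → Bool
inLeft = [ const true , const false ]′

inLeft-swap : ∀ {k} (s : Fin k ⊎ Fin k) → inLeft (swap s) ≡ not (inLeft s)
inLeft-swap (inj₁ _) = refl
inLeft-swap (inj₂ _) = refl

prismAdj-swap : ∀ {k} (B B′ : Pattern k) s → prismAdj B B′ s (swap s) ≡ true
prismAdj-swap B B′ (inj₁ i) = cong ⌊_⌋ (≡.≡-≟-identity _≟_ refl)
prismAdj-swap B B′ (inj₂ i) = cong ⌊_⌋ (≡.≡-≟-identity _≟_ refl)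

prismAdj-swap-unique : ∀ {k} (B B′ : Pattern k) s t → inLeft t ≡ not (inLeft s) →
  prismAdj B B′ s t ≡ true → t ≡ swap s
prismAdj-swap-unique B B′ (inj₁ i) (inj₂ j) _ _ with i ≟ j
... | yes refl = refl
prismAdj-swap-unique B B′ (inj₂ i) (inj₁ j) _ _ with i ≟ j
... | yes refl = refl

complete-left : ∀ {k} (s t : Fin k ⊎ Fin k) → inLeft s ≡ true → inLeft t ≡ true → s ≢ t →
  prismAdj complete empty s t ≡ true
complete-left (inj₁ i) (inj₁ j) _ _ s≢t = cong (not ∘ ⌊_⌋) (≡.≢-≟-identity _≟_ (s≢t ∘ cong inj₁))

empty-right : ∀ {k} (s t : Fin k ⊎ Fin k) → inLeft s ≡ false → inLeft t ≡ false →
  prismAdj complete empty s t ≡ false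
empty-right (inj₂ i) (inj₂ j) _ _ = refl

KnKnbar-isKnKnbar : ∀ n → IsKnKnbar (KnKnbar n)
KnKnbar-isKnKnbar n = record
  { side        = side
  ; matching    = matching
  ; clique      = λ x y sx sy x≢y →
      trans (KKadj≡prism n x y) (complete-left (splitAt n x) (splitAt n y) sx sy (x≢y ∘ splitAt-injective n))
  ; independent = λ x y sx sy _ → trans (KKadj≡prism n x y) (empty-right (splitAt n x) (splitAt n y) sx sy)
  }
  where
  side : Fin (n + n) → Bool
  side = inLeft ∘ splitAt n
  partner : Fin (n + n) → Fin (n + n)
  partner = join n n ∘ swap ∘ splitAt n
  splitAt-partner : ∀ x → splitAt n (partner x) ≡ swap (splitAt n x)
  splitAt-partner x = splitAt-join n n (swap (splitAt n x))
  matching : CrossMatching (KnKnbar n) side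
  matching x = partner x
    , trans (cong inLeft (splitAt-partner x)) (inLeft-swap (splitAt n x))
    , trans (KKadj≡prism n x (partner x))
        (trans (cong (prismAdj complete empty (splitAt n x)) (splitAt-partner x)) (prismAdj-swap complete empty (splitAt n x)))
    , λ y y-side xy → splitAt-injective n (trans
        (prismAdj-swap-unique complete empty (splitAt n x) (splitAt n y) y-side (trans (≡.sym (KKadj≡prism n x y)) xy))
        (≡.sym (splitAt-partner x)))

proposition3 : (n : ℕ) (G : Graph) → size G ≡ 2 * n → ExtendedP4Laden G →
    (CompSubPM G ⇔ (G ≅ KnKnbar n))
proposition3 n G |G|≡2n laden = mk⇔
  (λ compSub → IsKnKnbar⇒≅ {n = n} (CompSubPM⇒IsKnKnbar {G} laden compSub) |G|≡2n)
  (λ G≅KₙK̄ₙ → IsKnKnbar⇒CompSubPM (IsKnKnbar-transport {G} G≅KₙK̄ₙ (KnKnbar-isKnKnbar n)))
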